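{- Let $\alpha,\beta$ satisfy $2<\alpha\le 3$ and $4\alpha-\beta=6$, and let $G\in\mathcal G(\mathfrak B,\alpha,\beta)$. Then $G$ contains no pair of non-adjacent vertices having at least three common neighbors.
   Context: All graphs are finite and simple. $|G|$ is the number of vertices, $e(G)$ the number of edges, $G|_X$ the subgraph induced on $X$. $q_{\alpha,\beta}(G)=\alpha|G|-e(G)-\beta$. $\mathfrak B$ is the class of bipartite graphs. A vertex cut is a vertex set whose removal disconnects the graph; a bipartite cut of $G$ is a vertex cut $M$ with $G|_M$ bipartite. $\mathcal G(\mathfrak B,\alpha,\beta)$ is the set of graphs $G$ such that $|G|\ge4$, $q_{\alpha,\beta}(G)>0$, $G$ has no bipartite cut, and $G$ has the smallest number of vertices among all graphs with these three properties.
   Formalization: The parameters α and β range over the rationals instead of the reals. -}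

module Defs where

open import Data.Nat using (ℕ; zero; suc; _+_)
open import Data.Bool using (Bool; true; false; if_then_else_)
open import Data.Fin using (Fin; _<?_)
open import Data.List using (List; map; allFin)
open import Data.Nat.ListAction using (sum)
open import Data.Integer using (+_)
open import Data.Rational using (ℚ; _/_; _*_; _-_; _<_)
open import Data.Product using (Σ; _×_; ∃; ∃-syntax; _,_)
open import Relation.Nullary using (¬_; Dec; yes; no)
open import Relation.Binary.PropositionalEquality using (_≡_; _≢_)

record Graph (n : ℕ) : Set where
  field
    adj    : Fin n → Fin n → Bool
    sym    : ∀ i j → adj i j ≡ adj j i
    irrefl : ∀ i → adj i i ≡ false
open Graph public

_~[_]_ : {n : ℕ} → Fin n → Graph n → Fin n → Set
u ~[ G ] v = adj G u v ≡ true

order : {n : ℕ} → Graph n → ℕ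
order {n} _ = n

edgeCount : {n : ℕ} → Graph n → ℕ
edgeCount {n} G =
  sum (map (λ i → sum (map (λ j → pairVal i j) (allFin n))) (allFin n))
  where
    pairVal : Fin n → Fin n → ℕ
    pairVal i j with i <? j
    ... | yes _ = if adj G i j then 1 else 0
    ... | no _  = 0

ℕtoℚ : ℕ → ℚ
ℕtoℚ k = (+ k) / 1

q : ℚ → ℚ → {n : ℕ} → Graph n → ℚ
q α β G = (α * ℕtoℚ (order G) - ℕtoℚ (edgeCount G)) - β

VSet : ℕ → Set₁
VSet n = Fin n → Set

data Reach {n : ℕ} (G : Graph n) (M : VSet n) (u : Fin n) : Fin n → Set where
  here : ¬ M u → Reach G M u u
  step : ∀ {w v} → Reach G M u w → w ~[ G ] v → ¬ M v → Reach G M u v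

VertexCut : {n : ℕ} → Graph n → VSet n → Set
VertexCut G M = ∃[ u ] ∃[ v ] (¬ M u × ¬ M v × ¬ Reach G M u v)

InducedBipartite : {n : ℕ} → Graph n → VSet n → Set
InducedBipartite {n} G M =
  Σ (Fin n → Bool) λ c → ∀ u v → M u → M v → u ~[ G ] v → c u ≢ c v

BipartiteCut : {n : ℕ} → Graph n → VSet n → Set
BipartiteCut G M = VertexCut G M × InducedBipartite G M

Admissible : ℚ → ℚ → {n : ℕ} → Graph n → Set₁
Admissible α β {n} G =
  (4 Data.Nat.≤ n) × (ℕtoℚ 0 < q α β G) × (∀ (M : VSet n) → ¬ BipartiteCut G M)

InClass : ℚ → ℚ → {n : ℕ} → Graph n → Set₁
InClass α β {n} G =
  Admissible α β G × (∀ (m : ℕ) (H : Graph m) → Admissible α β H → n Data.Nat.≤ m)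

{-# OPTIONS --safe #-}
-- Merge v into u: delete v and join u to every neighbour of v. As u and v are not
-- adjacent, collapsing v onto u is a homomorphism onto the merged graph H, and it has
-- a section, so a bipartite cut of H pulls back to one of G. H has one vertex less and
-- loses one edge per common neighbour, hence at least three, so q(H) - q(G) ≥ 3 - α ≥ 0;
-- and H still contains u and the three common neighbours, so |H| ≥ 4. Thus H contradicts
-- the minimality of G.
module Submission where

open import Defs
open import Data.Bool using (Bool; true; false; if_then_else_; _∧_; _∨_)
open import Data.Bool.Properties using (∨-comm; ∨-identityʳ; ∨-zeroʳ; ∧-zeroʳ)
open import Data.Empty using (⊥-elim)
open import Data.Fin using (Fin; zero; suc; punchIn; punchOut; _≟_; _<?_)
open import Data.Fin.Properties using (punchInᵢ≢i; punchIn-punchOut; punchOut-cong; punchOut-punchIn)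
open import Data.List using (map; allFin; tabulate)
open import Data.List.Properties using (map-tabulate)
import Data.Nat.ListAction as List
open import Data.Nat using (ℕ; zero; suc)
import Data.Nat as ℕ
import Data.Nat.Properties as ℕ
open import Algebra.Properties.CommutativeMonoid.Sum ℕ.+-0-commutativeMonoid
  using (sum; sum-syntax; sum-cong-≗; sum-remove; ∑-distrib-+; sum-replicate-zero)
open import Data.Product using (_×_; ∃-syntax; _,_)
open import Function using (_∘_)
open import Relation.Nullary using (¬_; Dec; yes; no; does)
open import Relation.Nullary.Decidable using (dec-true; dec-false)
open import Relation.Binary.PropositionalEquality as ≡ using (_≡_; _≢_; refl; cong; cong₂; subst; subst₂)

module Counting where

  open import Data.Nat using (_+_; _≤_; _<_; z≤n; s≤s)

  𝟙 : Bool → ℕ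
  𝟙 b = if b then 1 else 0

  𝟙-∨-∧ : ∀ p q → 𝟙 (p ∨ q) + 𝟙 (p ∧ q) ≡ 𝟙 p + 𝟙 q
  𝟙-∨-∧ true  true  = refl
  𝟙-∨-∧ true  false = refl
  𝟙-∨-∧ false q     = ℕ.+-identityʳ (𝟙 q)

  sum-map-allFin : ∀ {n} (f : Fin n → ℕ) → List.sum (map f (allFin n)) ≡ ∑[ i < n ] f i
  sum-map-allFin {n} f = ≡.trans (cong List.sum (map-tabulate (λ i → i) f)) (sum-tabulate f)
    where
    sum-tabulate : ∀ {k} (g : Fin k → ℕ) → List.sum (tabulate g) ≡ ∑[ i < k ] g i
    sum-tabulate {zero}  g = refl
    sum-tabulate {suc k} g = cong (g zero +_) (sum-tabulate (g ∘ suc))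

  sum-remove-zero : ∀ {n} (f : Fin (suc n) → ℕ) {x} → f x ≡ 0 → ∑[ i < suc n ] f i ≡ ∑[ j < n ] f (punchIn x j)
  sum-remove-zero f {x} fx≡0 = ≡.trans (sum-remove {i = x} f) (cong (_+ sum (f ∘ punchIn x)) fx≡0)

  ∑-mono-≤ : ∀ {n} {f g : Fin n → ℕ} → (∀ i → f i ≤ g i) → ∑[ i < n ] f i ≤ ∑[ i < n ] g i
  ∑-mono-≤ {zero}  f≤g = z≤n
  ∑-mono-≤ {suc n} f≤g = ℕ.+-mono-≤ (f≤g zero) (∑-mono-≤ (f≤g ∘ suc))

  count-≤ : ∀ {n} (p : Fin n → Bool) → ∑[ i < n ] 𝟙 (p i) ≤ n
  count-≤ {zero}  p = z≤n
  count-≤ {suc n} p = ℕ.+-mono-≤ (𝟙≤1 (p zero)) (count-≤ (p ∘ suc))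
    where
    𝟙≤1 : ∀ b → 𝟙 b ≤ 1
    𝟙≤1 true  = s≤s z≤n
    𝟙≤1 false = z≤n

  count-< : ∀ {n} (p : Fin n → Bool) {x} → p x ≡ false → ∑[ i < n ] 𝟙 (p i) < n
  count-< {suc n} p {x} px≡false
    rewrite sum-remove-zero (𝟙 ∘ p) {x} (cong 𝟙 px≡false) = s≤s (count-≤ (p ∘ punchIn x))

  ∑-𝟙-≟ : ∀ {n} (a : Fin n) → ∑[ i < n ] 𝟙 (does (i ≟ a)) ≡ 1
  ∑-𝟙-≟ {suc n} a = begin
    ∑[ i < suc n ] 𝟙 (does (i ≟ a))                          ≡⟨ sum-remove {i = a} (λ i → 𝟙 (does (i ≟ a))) ⟩
    𝟙 (does (a ≟ a)) + ∑[ j < n ] 𝟙 (does (punchIn a j ≟ a)) ≡⟨ cong₂ _+_ (cong 𝟙 (dec-true (a ≟ a) refl)) (sum-cong-≗ off-a) ⟩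
    1 + ∑[ j < n ] 0                                          ≡⟨ cong (1 +_) (sum-replicate-zero n) ⟩
    1                                                         ∎
    where
    open ≡.≡-Reasoning
    off-a : ∀ j → 𝟙 (does (punchIn a j ≟ a)) ≡ 0
    off-a j = cong 𝟙 (dec-false (punchIn a j ≟ a) (punchInᵢ≢i a j))

  count-≥3 : ∀ {n} (p : Fin n → Bool) {a b c : Fin n} → a ≢ b → a ≢ c → b ≢ c →
             p a ≡ true → p b ≡ true → p c ≡ true → 3 ≤ ∑[ i < n ] 𝟙 (p i)
  count-≥3 {n} p {a} {b} {c} a≢b a≢c b≢c pa pb pc = begin
    3                                      ≡⟨ cong₂ _+_ (≡.sym (∑-𝟙-≟ a)) (cong₂ _+_ (≡.sym (∑-𝟙-≟ b)) (≡.sym (∑-𝟙-≟ c))) ⟩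
    sum (δ a) + (sum (δ b) + sum (δ c))    ≡⟨ cong (sum (δ a) +_) (∑-distrib-+ (δ b) (δ c)) ⟨
    sum (δ a) + ∑[ i < n ] (δ b i + δ c i) ≡⟨ ∑-distrib-+ (δ a) (λ i → δ b i + δ c i) ⟨
    ∑[ i < n ] (δ a i + (δ b i + δ c i))   ≤⟨ ∑-mono-≤ indicators≤p ⟩
    ∑[ i < n ] 𝟙 (p i)                     ∎
    where
    open ℕ.≤-Reasoning
    δ : Fin n → Fin n → ℕ
    δ x i = 𝟙 (does (i ≟ x))
    indicators≤p : ∀ i → δ a i + (δ b i + δ c i) ≤ 𝟙 (p i)
    indicators≤p i with i ≟ a | i ≟ b | i ≟ c
    ... | yes refl | yes refl | _        = ⊥-elim (a≢b refl)
    ... | yes refl | no _     | yes refl = ⊥-elim (a≢c refl)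
    ... | no _     | yes refl | yes refl = ⊥-elim (b≢c refl)
    ... | yes refl | no _     | no _     rewrite pa = ℕ.≤-refl
    ... | no _     | yes refl | no _     rewrite pb = ℕ.≤-refl
    ... | no _     | no _     | yes refl rewrite pc = ℕ.≤-refl
    ... | no _     | no _     | no _     = z≤n

module EdgeCount where

  open import Data.Nat using (_+_)
  open import Data.Fin using () renaming (_<_ to _<ᶠ_)
  open import Data.Fin.Properties using (<-cmp; <-irrefl; punchIn-mono-≤; punchIn-cancel-≤)
  open import Relation.Binary.Definitions using (tri<; tri≈; tri>)
  open Counting

  -- Defs hides the summand of edgeCount in a where-block; unifying against the
  -- unfolded definition recovers it.
  edgeSummand : ∀ {n} → Graph n → Fin n → Fin n → ℕ
  edgeSummand {n} G = summandOf refl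
    where
    summandOf : ∀ {F : Fin n → Fin n → ℕ} →
                List.sum (map (λ i → List.sum (map (F i) (allFin n))) (allFin n)) ≡ edgeCount G →
                Fin n → Fin n → ℕ
    summandOf {F} _ = F

  edgeCount-∑∑ : ∀ {n} (G : Graph n) → edgeCount G ≡ ∑[ i < n ] ∑[ j < n ] edgeSummand G i j
  edgeCount-∑∑ {n} G = ≡.trans (sum-map-allFin (λ i → List.sum (map (edgeSummand G i) (allFin n))))
                                (sum-cong-≗ (λ i → sum-map-allFin (edgeSummand G i)))

  edgeSummand-< : ∀ {n} (G : Graph n) {i j} → i <ᶠ j → edgeSummand G i j ≡ 𝟙 (adj G i j)
  edgeSummand-< G {i} {j} i<j with i <? j
  ... | yes _   = refl
  ... | no i≮j = ⊥-elim (i≮j i<j)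

  edgeSummand-≮ : ∀ {n} (G : Graph n) {i j} → ¬ i <ᶠ j → edgeSummand G i j ≡ 0
  edgeSummand-≮ G {i} {j} i≮j with i <? j
  ... | yes i<j = ⊥-elim (i≮j i<j)
  ... | no _    = refl

  edgeSummand-pair : ∀ {n} (G : Graph n) i j → edgeSummand G i j + edgeSummand G j i ≡ 𝟙 (adj G i j)
  edgeSummand-pair G i j with <-cmp i j
  ... | tri< i<j _ j≮i rewrite edgeSummand-< G i<j | edgeSummand-≮ G j≮i = ℕ.+-identityʳ _
  ... | tri≈ i≮i refl _ rewrite edgeSummand-≮ G i≮i | irrefl G i = refl
  ... | tri> i≮j _ j<i rewrite edgeSummand-≮ G i≮j | edgeSummand-< G j<i | sym G i j = refl

  edgeSummand-agree : ∀ {n n′} (G : Graph n) (G′ : Graph n′) {i j i′ j′} →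
    (i <ᶠ j → i′ <ᶠ j′) → (i′ <ᶠ j′ → i <ᶠ j) → adj G i j ≡ adj G′ i′ j′ →
    edgeSummand G i j ≡ edgeSummand G′ i′ j′
  edgeSummand-agree G G′ {i} {j} {i′} {j′} to from same = byCases (i <? j)
    where
    byCases : Dec (i <ᶠ j) → edgeSummand G i j ≡ edgeSummand G′ i′ j′
    byCases (yes i<j) = ≡.trans (edgeSummand-< G i<j) (≡.trans (cong 𝟙 same) (≡.sym (edgeSummand-< G′ (to i<j))))
    byCases (no i≮j)  = ≡.trans (edgeSummand-≮ G i≮j) (≡.sym (edgeSummand-≮ G′ (i≮j ∘ from)))

  edgeCount-cong : ∀ {n} {G G′ : Graph n} → (∀ a b → adj G a b ≡ adj G′ a b) → edgeCount G ≡ edgeCount G′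
  edgeCount-cong {n} {G} {G′} same = begin
    edgeCount G                               ≡⟨ edgeCount-∑∑ G ⟩
    ∑[ a < n ] ∑[ b < n ] edgeSummand G a b   ≡⟨ sum-cong-≗ (λ a → sum-cong-≗ (λ b → summand-cong a b)) ⟩
    ∑[ a < n ] ∑[ b < n ] edgeSummand G′ a b  ≡⟨ edgeCount-∑∑ G′ ⟨
    edgeCount G′                              ∎
    where
    open ≡.≡-Reasoning
    summand-cong : ∀ a b → edgeSummand G a b ≡ edgeSummand G′ a b
    summand-cong a b = edgeSummand-agree G G′ (λ a<b → a<b) (λ a<b → a<b) (same a b)

  deleteVertex : ∀ {n} → Graph (suc n) → Fin (suc n) → Graph n
  deleteVertex G v = record
    { adj    = λ a b → adj G (punchIn v a) (punchIn v b)
    ; sym    = λ a b → sym G (punchIn v a) (punchIn v b)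
    ; irrefl = λ a → irrefl G (punchIn v a)
    }

  punchIn-mono-< : ∀ {n} (v : Fin (suc n)) {a b} → a <ᶠ b → punchIn v a <ᶠ punchIn v b
  punchIn-mono-< v {a} {b} a<b = ℕ.≰⇒> (ℕ.<⇒≱ a<b ∘ punchIn-cancel-≤ v b a)

  punchIn-cancel-< : ∀ {n} (v : Fin (suc n)) {a b} → punchIn v a <ᶠ punchIn v b → a <ᶠ b
  punchIn-cancel-< v {a} {b} πa<πb = ℕ.≰⇒> (ℕ.<⇒≱ πa<πb ∘ punchIn-mono-≤ v b a)

  edgeSummand-deleteVertex : ∀ {n} (G : Graph (suc n)) v a b →
    edgeSummand (deleteVertex G v) a b ≡ edgeSummand G (punchIn v a) (punchIn v b)
  edgeSummand-deleteVertex G v a b =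
    edgeSummand-agree (deleteVertex G v) G (punchIn-mono-< v) (punchIn-cancel-< v) refl

  edgeCount-deleteVertex : ∀ {n} (G : Graph (suc n)) v →
    edgeCount G ≡ edgeCount (deleteVertex G v) + ∑[ b < n ] 𝟙 (adj G v (punchIn v b))
  edgeCount-deleteVertex {n} G v = begin
    edgeCount G
      ≡⟨ edgeCount-∑∑ G ⟩
    ∑[ i < suc n ] ∑[ j < suc n ] S i j
      ≡⟨ sum-remove {i = v} (λ i → ∑[ j < suc n ] S i j) ⟩
    ∑[ j < suc n ] S v j + ∑[ a < n ] ∑[ j < suc n ] S (π a) j
      ≡⟨ cong₂ _+_ (sum-remove-zero (S v) {v} (edgeSummand-≮ G {v} {v} (<-irrefl refl)))
                   (sum-cong-≗ (λ a → sum-remove {i = v} (S (π a)))) ⟩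
    outgoing + ∑[ a < n ] (S (π a) v + ∑[ b < n ] S (π a) (π b))
      ≡⟨ cong (outgoing +_) (∑-distrib-+ (λ a → S (π a) v) (λ a → ∑[ b < n ] S (π a) (π b))) ⟩
    outgoing + (incoming + rest)
      ≡⟨ ≡.sym (ℕ.+-assoc outgoing incoming rest) ⟩
    (outgoing + incoming) + rest
      ≡⟨ ℕ.+-comm (outgoing + incoming) rest ⟩
    rest + (outgoing + incoming)
      ≡⟨ cong₂ _+_ deleted incident ⟩
    edgeCount (deleteVertex G v) + ∑[ b < n ] 𝟙 (adj G v (π b))
      ∎
    where
    open ≡.≡-Reasoning
    S = edgeSummand G
    π = punchIn v
    outgoing = ∑[ b < n ] S v (π b)
    incoming = ∑[ b < n ] S (π b) v
    rest     = ∑[ a < n ] ∑[ b < n ] S (π a) (π b)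
    deleted : rest ≡ edgeCount (deleteVertex G v)
    deleted = ≡.sym (≡.trans (edgeCount-∑∑ (deleteVertex G v))
                             (sum-cong-≗ (λ a → sum-cong-≗ (edgeSummand-deleteVertex G v a))))
    incident : outgoing + incoming ≡ ∑[ b < n ] 𝟙 (adj G v (π b))
    incident = ≡.trans (≡.sym (∑-distrib-+ (λ b → S v (π b)) (λ b → S (π b) v)))
                       (sum-cong-≗ (λ b → edgeSummand-pair G v (π b)))

module Contraction where

  open import Data.Nat using (_+_; _<_)
  open Counting
  open EdgeCount

  addNeighbours : ∀ {n} (K : Graph n) (x : Fin n) (N : Fin n → Bool) → N x ≡ false → Graph n
  addNeighbours K x N Nx≡false = record
    { adj    = λ a b → adj K a b ∨ (does (a ≟ x) ∧ N b) ∨ (does (b ≟ x) ∧ N a)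
    ; sym    = symmetric
    ; irrefl = irreflexive
    }
    where
    symmetric : ∀ a b → adj K a b ∨ (does (a ≟ x) ∧ N b) ∨ (does (b ≟ x) ∧ N a)
                      ≡ adj K b a ∨ (does (b ≟ x) ∧ N a) ∨ (does (a ≟ x) ∧ N b)
    symmetric a b rewrite sym K a b = cong (adj K b a ∨_) (∨-comm (does (a ≟ x) ∧ N b) (does (b ≟ x) ∧ N a))
    irreflexive : ∀ a → adj K a a ∨ (does (a ≟ x) ∧ N a) ∨ (does (a ≟ x) ∧ N a) ≡ false
    irreflexive a rewrite irrefl K a with a ≟ x
    ... | yes refl rewrite Nx≡false = refl
    ... | no _     = refl

  module _ {n} (K : Graph n) (x : Fin n) (N : Fin n → Bool) (Nx≡false : N x ≡ false) where

    addNeighbours-⊇ : ∀ {a b} → a ~[ K ] b → a ~[ addNeighbours K x N Nx≡false ] b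
    addNeighbours-⊇ a~b rewrite a~b = refl

    addNeighbours-new : ∀ {b} → N b ≡ true → x ~[ addNeighbours K x N Nx≡false ] b
    addNeighbours-new {b} Nb rewrite dec-true (x ≟ x) refl | Nb = ∨-zeroʳ (adj K x b)

  edgeCount-addNeighbours : ∀ {n} (K : Graph n) x N (Nx≡false : N x ≡ false) →
    edgeCount (addNeighbours K x N Nx≡false) + ∑[ b < n ] 𝟙 (adj K x b ∧ N b)
      ≡ edgeCount K + ∑[ b < n ] 𝟙 (N b)
  edgeCount-addNeighbours {suc n} K x N Nx≡false = begin
    edgeCount H + ∑[ b < suc n ] 𝟙 (adj K x b ∧ N b)
      ≡⟨ cong₂ _+_ (edgeCount-deleteVertex H x) (sum-remove-zero (λ b → 𝟙 (adj K x b ∧ N b)) {x} noLoop) ⟩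
    (edgeCount (deleteVertex H x) + rowH) + both
      ≡⟨ ℕ.+-assoc (edgeCount (deleteVertex H x)) rowH both ⟩
    edgeCount (deleteVertex H x) + (rowH + both)
      ≡⟨ cong₂ _+_ (edgeCount-cong awayFromx) incidentAtx ⟩
    edgeCount (deleteVertex K x) + (rowK + new)
      ≡⟨ ℕ.+-assoc (edgeCount (deleteVertex K x)) rowK new ⟨
    (edgeCount (deleteVertex K x) + rowK) + new
      ≡⟨ cong₂ _+_ (edgeCount-deleteVertex K x) (sum-remove-zero (𝟙 ∘ N) {x} (cong 𝟙 Nx≡false)) ⟨
    edgeCount K + ∑[ b < suc n ] 𝟙 (N b)
      ∎
    where
    open ≡.≡-Reasoning
    H = addNeighbours K x N Nx≡false
    π = punchIn x
    rowH = ∑[ c < n ] 𝟙 (adj H x (π c))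
    rowK = ∑[ c < n ] 𝟙 (adj K x (π c))
    both = ∑[ c < n ] 𝟙 (adj K x (π c) ∧ N (π c))
    new  = ∑[ c < n ] 𝟙 (N (π c))
    noLoop : 𝟙 (adj K x x ∧ N x) ≡ 0
    noLoop = cong (λ b → 𝟙 (b ∧ N x)) (irrefl K x)
    awayFromx : ∀ a b → adj H (π a) (π b) ≡ adj K (π a) (π b)
    awayFromx a b rewrite dec-false (π a ≟ x) (punchInᵢ≢i x a) | dec-false (π b ≟ x) (punchInᵢ≢i x b) =
      ∨-identityʳ (adj K (π a) (π b))
    atx : ∀ c → 𝟙 (adj H x (π c)) + 𝟙 (adj K x (π c) ∧ N (π c)) ≡ 𝟙 (adj K x (π c)) + 𝟙 (N (π c))
    atx c rewrite dec-true (x ≟ x) refl | dec-false (π c ≟ x) (punchInᵢ≢i x c) | ∨-identityʳ (N (π c)) =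
      𝟙-∨-∧ (adj K x (π c)) (N (π c))
    incidentAtx : rowH + both ≡ rowK + new
    incidentAtx = begin
      rowH + both                                                   ≡⟨ ∑-distrib-+ (λ c → 𝟙 (adj H x (π c))) _ ⟨
      ∑[ c < n ] (𝟙 (adj H x (π c)) + 𝟙 (adj K x (π c) ∧ N (π c))) ≡⟨ sum-cong-≗ atx ⟩
      ∑[ c < n ] (𝟙 (adj K x (π c)) + 𝟙 (N (π c)))                 ≡⟨ ∑-distrib-+ (λ c → 𝟙 (adj K x (π c))) _ ⟩
      rowK + new                                                    ∎

  commonNeighbours : ∀ {n} → Graph n → Fin n → Fin n → ℕ
  commonNeighbours {n} G u v = ∑[ y < n ] 𝟙 (adj G u y ∧ adj G v y)

  commonNeighbours-punchIn : ∀ {m} (G : Graph (suc m)) u v →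
    commonNeighbours G u v ≡ ∑[ b < m ] 𝟙 (adj G u (punchIn v b) ∧ adj G v (punchIn v b))
  commonNeighbours-punchIn G u v = sum-remove-zero (λ y → 𝟙 (adj G u y ∧ adj G v y)) {v} notAtv
    where
    notAtv : 𝟙 (adj G u v ∧ adj G v v) ≡ 0
    notAtv rewrite irrefl G v = cong 𝟙 (∧-zeroʳ (adj G u v))

  commonNeighbours-< : ∀ {m} (G : Graph (suc m)) {u v} → u ≢ v → commonNeighbours G u v < m
  commonNeighbours-< G {u} {v} u≢v rewrite commonNeighbours-punchIn G u v =
    count-< (λ b → adj G u (punchIn v b) ∧ adj G v (punchIn v b)) {punchOut v≢u} notAtu
    where
    v≢u : v ≢ u
    v≢u = u≢v ∘ ≡.sym
    notAtu : adj G u (punchIn v (punchOut v≢u)) ∧ adj G v (punchIn v (punchOut v≢u)) ≡ false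
    notAtu rewrite punchIn-punchOut v≢u | irrefl G u = refl

  module Merge {m} (G : Graph (suc m)) {u v : Fin (suc m)} (v≢u : v ≢ u) (u≁v : adj G u v ≡ false) where

    u₀ : Fin m
    u₀ = punchOut v≢u

    punchIn-u₀ : punchIn v u₀ ≡ u
    punchIn-u₀ = punchIn-punchOut v≢u

    neighbourOfv : Fin m → Bool
    neighbourOfv b = adj G v (punchIn v b)

    u₀-notNeighbourOfv : neighbourOfv u₀ ≡ false
    u₀-notNeighbourOfv = ≡.trans (cong (adj G v) punchIn-u₀) (≡.trans (sym G v u) u≁v)

    merged : Graph m
    merged = addNeighbours (deleteVertex G v) u₀ neighbourOfv u₀-notNeighbourOfv

    edgeCount-merged : edgeCount merged + commonNeighbours G u v ≡ edgeCount G
    edgeCount-merged = begin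
      edgeCount merged + commonNeighbours G u v
        ≡⟨ cong (edgeCount merged +_) (≡.trans (commonNeighbours-punchIn G u v) (sum-cong-≗ atu₀)) ⟩
      edgeCount merged + ∑[ b < m ] 𝟙 (adj (deleteVertex G v) u₀ b ∧ neighbourOfv b)
        ≡⟨ edgeCount-addNeighbours (deleteVertex G v) u₀ neighbourOfv u₀-notNeighbourOfv ⟩
      edgeCount (deleteVertex G v) + ∑[ b < m ] 𝟙 (neighbourOfv b)
        ≡⟨ ≡.sym (edgeCount-deleteVertex G v) ⟩
      edgeCount G
        ∎
      where
      open ≡.≡-Reasoning
      atu₀ : ∀ b → 𝟙 (adj G u (punchIn v b) ∧ neighbourOfv b) ≡ 𝟙 (adj (deleteVertex G v) u₀ b ∧ neighbourOfv b)
      atu₀ b = cong (λ y → 𝟙 (adj G y (punchIn v b) ∧ neighbourOfv b)) (≡.sym punchIn-u₀)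

    collapse : Fin (suc m) → Fin m
    collapse x with v ≟ x
    ... | yes _   = u₀
    ... | no v≢x = punchOut v≢x

    collapse-punchIn : ∀ a → collapse (punchIn v a) ≡ a
    collapse-punchIn a with v ≟ punchIn v a
    ... | yes v≡πa = ⊥-elim (punchInᵢ≢i v a (≡.sym v≡πa))
    ... | no _      = ≡.trans (punchOut-cong v refl) (punchOut-punchIn v)

    collapse-hom : ∀ {x y} → x ~[ G ] y → collapse x ~[ merged ] collapse y
    collapse-hom {x} {y} x~y with v ≟ x | v ≟ y
    ... | yes refl | yes refl = ⊥-elim (noLoop (≡.trans (≡.sym x~y) (irrefl G v)))
      where
      noLoop : true ≢ false
      noLoop ()
    ... | yes refl | no v≢y =
      addNeighbours-new (deleteVertex G v) u₀ neighbourOfv u₀-notNeighbourOfv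
        (≡.trans (cong (adj G v) (punchIn-punchOut v≢y)) x~y)
    ... | no v≢x | yes refl =
      ≡.trans (sym merged (punchOut v≢x) u₀)
        (addNeighbours-new (deleteVertex G v) u₀ neighbourOfv u₀-notNeighbourOfv
          (≡.trans (cong (adj G v) (punchIn-punchOut v≢x)) (≡.trans (sym G v x) x~y)))
    ... | no v≢x | no v≢y =
      addNeighbours-⊇ (deleteVertex G v) u₀ neighbourOfv u₀-notNeighbourOfv
        (≡.trans (cong₂ (adj G) (punchIn-punchOut v≢x) (punchIn-punchOut v≢y)) x~y)

Reach-map : ∀ {n m} {G : Graph n} {H : Graph m} {f : Fin n → Fin m} (M : VSet m) →
  (∀ {x y} → x ~[ G ] y → f x ~[ H ] f y) → ∀ {x y} → Reach G (M ∘ f) x y → Reach H M (f x) (f y)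
Reach-map M hom (here x∉M)       = here x∉M
Reach-map M hom (step r w~y y∉M) = step (Reach-map M hom r) (hom w~y) y∉M

bipartiteCut-pullback : ∀ {n m} {G : Graph n} {H : Graph m} (f : Fin n → Fin m) (s : Fin m → Fin n) →
  (∀ a → f (s a) ≡ a) → (∀ {x y} → x ~[ G ] y → f x ~[ H ] f y) →
  ∀ {M} → BipartiteCut H M → BipartiteCut G (M ∘ f)
bipartiteCut-pullback {H = H} f s f∘s≡id hom {M} ((a , b , a∉M , b∉M , a↛b) , colour , proper) =
  ( s a , s b , a∉M ∘ subst M (f∘s≡id a) , b∉M ∘ subst M (f∘s≡id b)
  , a↛b ∘ subst₂ (Reach H M) (f∘s≡id a) (f∘s≡id b) ∘ Reach-map M hom )
  , colour ∘ f , λ x y x∈M y∈M x~y → proper (f x) (f y) x∈M y∈M (hom x~y)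

module Potential where

  open import Data.Integer using (+_)
  import Data.Integer as ℤ
  import Data.Integer.Properties as ℤ
  open import Data.Nat.Coprimality using (Coprime; 1-coprimeTo)
  import Data.Nat.Coprimality as Coprime
  open import Data.Rational using (ℚ; mkℚ; _+_; _*_; _-_; -_; _≤_; 0ℚ; 1ℚ)
  open import Data.Rational.Properties
    using (normalize-coprime; /-cong; normalize-nonNeg; nonNegative⁻¹; +-mono-≤; +-monoˡ-≤; +-monoʳ-≤;
           +-inverseʳ; +-identityʳ; module ≤-Reasoning)
  open import Data.Rational.Solver using (module +-*-Solver)

  coprimeTo1 : ∀ a → Coprime a 1
  coprimeTo1 a = Coprime.sym (1-coprimeTo a)

  ℕtoℚ-mkℚ : ∀ a → ℕtoℚ a ≡ mkℚ (+ a) 0 (coprimeTo1 a)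
  ℕtoℚ-mkℚ a = normalize-coprime (coprimeTo1 a)

  ℕtoℚ-+ : ∀ a b → ℕtoℚ (a ℕ.+ b) ≡ ℕtoℚ a + ℕtoℚ b
  ℕtoℚ-+ a b = ≡.trans (/-cong {p₂ = (+ a) ℤ.* (+ 1) ℤ.+ (+ b) ℤ.* (+ 1)} {q₂ = 1} numerator refl)
                       (≡.sym (cong₂ _+_ (ℕtoℚ-mkℚ a) (ℕtoℚ-mkℚ b)))
    where
    numerator : + (a ℕ.+ b) ≡ (+ a) ℤ.* (+ 1) ℤ.+ (+ b) ℤ.* (+ 1)
    numerator = ≡.trans (ℤ.pos-+ a b) (≡.sym (cong₂ ℤ._+_ (ℤ.*-identityʳ (+ a)) (ℤ.*-identityʳ (+ b))))

  ℕtoℚ-nonNeg : ∀ a → 0ℚ ≤ ℕtoℚ a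
  ℕtoℚ-nonNeg a = nonNegative⁻¹ (ℕtoℚ a) {{normalize-nonNeg a 1}}

  q-≤-removal : ∀ {α β : ℚ} {k m} (G : Graph (suc m)) (H : Graph m) →
    α ≤ ℕtoℚ k → edgeCount H ℕ.+ k ℕ.≤ edgeCount G → q α β G ≤ q α β H
  q-≤-removal {α} {β} {k} {m} G H α≤k fewerEdges = begin
    q α β G
      ≡⟨ cong₂ (λ s t → (α * s - t) - β) (ℕtoℚ-+ 1 m) split ⟩
    (α * (1ℚ + M) - ((E′ + K) + D)) - β
      ≡⟨ ≡.sym (+-identityʳ _) ⟩
    (α * (1ℚ + M) - ((E′ + K) + D)) - β + 0ℚ
      ≤⟨ +-monoʳ-≤ ((α * (1ℚ + M) - ((E′ + K) + D)) - β) slack≥0 ⟩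
    (α * (1ℚ + M) - ((E′ + K) + D)) - β + ((K - α) + D)
      ≡⟨ rearrange α β M E′ K D ⟩
    q α β H
      ∎
    where
    open ≤-Reasoning
    open +-*-Solver
    d = edgeCount G ℕ.∸ (edgeCount H ℕ.+ k)
    M = ℕtoℚ m
    E′ = ℕtoℚ (edgeCount H)
    K = ℕtoℚ k
    D = ℕtoℚ d
    split : ℕtoℚ (edgeCount G) ≡ (E′ + K) + D
    split = ≡.trans (cong ℕtoℚ (≡.sym (ℕ.m+[n∸m]≡n fewerEdges)))
                    (≡.trans (ℕtoℚ-+ (edgeCount H ℕ.+ k) d) (cong (_+ D) (ℕtoℚ-+ (edgeCount H) k)))
    slack≥0 : 0ℚ ≤ (K - α) + D
    slack≥0 = +-mono-≤ (subst (_≤ K - α) (+-inverseʳ α) (+-monoˡ-≤ (- α) α≤k)) (ℕtoℚ-nonNeg d)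
    rearrange : ∀ α β M E′ K D → (α * (1ℚ + M) - ((E′ + K) + D)) - β + ((K - α) + D) ≡ (α * M - E′) - β
    rearrange = solve 6 (λ α β M E′ K D →
      ((α :* (con 1ℚ :+ M) :- ((E′ :+ K) :+ D)) :- β) :+ ((K :- α) :+ D) := (α :* M :- E′) :- β) refl

open Counting using (count-≥3)
open Contraction using (commonNeighbours; commonNeighbours-<; module Merge)
open Potential using (q-≤-removal)
open import Data.Integer using (+_)
open import Data.Rational using (ℚ; _/_; _*_; _-_; _<_; _≤_)
import Data.Rational.Properties as ℚ

lemma14 : (α β : ℚ) → ((+ 2) / 1) < α → α ≤ ((+ 3) / 1) → ((+ 4) / 1) * α - β ≡ (+ 6) / 1 →
    (n : ℕ) (G : Graph n) → InClass α β G →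
    ¬ (∃[ u ] ∃[ v ] (u ≢ v × adj G u v ≡ false ×
         (∃[ w₁ ] ∃[ w₂ ] ∃[ w₃ ] (w₁ ≢ w₂ × w₁ ≢ w₃ × w₂ ≢ w₃ ×
            u ~[ G ] w₁ × v ~[ G ] w₁ × u ~[ G ] w₂ × v ~[ G ] w₂ × u ~[ G ] w₃ × v ~[ G ] w₃))))
lemma14 _ _ _ _ _ zero _ _ (() , _)
lemma14 α β _ α≤3 _ (suc m) G ((_ , q>0 , noCut) , minimal)
  (u , v , u≢v , u≁v , w₁ , w₂ , w₃ , w₁≢w₂ , w₁≢w₃ , w₂≢w₃ , u~w₁ , v~w₁ , u~w₂ , v~w₂ , u~w₃ , v~w₃) =
  ℕ.1+n≰n (minimal m merged (4≤m , ℚ.<-≤-trans q>0 (q-≤-removal G merged α≤3 fewerEdges) , noCutMerged))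
  where
  open Merge G (u≢v ∘ ≡.sym) u≁v
  3≤common : 3 ℕ.≤ commonNeighbours G u v
  3≤common = count-≥3 (λ y → adj G u y ∧ adj G v y) w₁≢w₂ w₁≢w₃ w₂≢w₃
               (cong₂ _∧_ u~w₁ v~w₁) (cong₂ _∧_ u~w₂ v~w₂) (cong₂ _∧_ u~w₃ v~w₃)
  4≤m : 4 ℕ.≤ m
  4≤m = ℕ.≤-trans (ℕ.s≤s 3≤common) (commonNeighbours-< G u≢v)
  fewerEdges : edgeCount merged ℕ.+ 3 ℕ.≤ edgeCount G
  fewerEdges = subst (edgeCount merged ℕ.+ 3 ℕ.≤_) edgeCount-merged (ℕ.+-monoʳ-≤ (edgeCount merged) 3≤common)
  noCutMerged : ∀ M → ¬ BipartiteCut merged M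
  noCutMerged M cut =
    noCut (M ∘ collapse) (bipartiteCut-pullback collapse (punchIn v) collapse-punchIn collapse-hom cut)
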